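{- In the multirole logic MRL over a set of roles $\mathcal{R}$, for every sequent $\Gamma$, every $R\subseteq\mathcal{R}$ and every formula $A$, the sequent $\vdash\Gamma,[R]A,[\mathcal{R}\setminus R]A$ is derivable.
   Context: Fix a set $\mathcal{R}$ (the set of roles), possibly infinite. For $R\subseteq\mathcal{R}$ write $\overline{R}=\mathcal{R}\setminus R$. Writing $R_1\uplus\cdots\uplus R_n$ means the union of the pairwise disjoint sets $R_1,\dots,R_n$ (the notation asserts disjointness). A filter on $\mathcal{R}$ is a set $\mathcal{F}$ of subsets of $\mathcal{R}$ with $\mathcal{R}\in\mathcal{F}$, such that $R_1\in\mathcal{F}$ and $R_1\subseteq R_2$ imply $R_2\in\mathcal{F}$, and $R_1,R_2\in\mathcal{F}$ imply $R_1\cap R_2\in\mathcal{F}$; an ultrafilter $\mathcal{U}$ is a filter such that for every $R\subseteq\mathcal{R}$, $R\in\mathcal{U}$ or $\overline{R}\in\mathcal{U}$. An endomorphism is any function $f:\mathcal{R}\to\mathcal{R}$, and $f^{ -1}(R)$ is the preimage. First-order terms $t$ and atomic formulas $a$ are standard. Formulas of MRL: $A ::= a \mid \neg_f(A) \mid A_1\wedge_{\mathcal{U}}A_2 \mid A\supset_{f,\mathcal{U}}B \mid \forall_{\mathcal{U}}(\lambda x.A)$, with $f$ an endomorphism and $\mathcal{U}$ an ultrafilter on $\mathcal{R}$; $A[x:=t]$ is substitution. An i-formula is $[R]A$ with $R\subseteq\mathcal{R}$ and $A$ a formula. A sequent $\Gamma$ is a finite multiset of i-formulas; commas denote multiset union.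 Derivable sequents $\vdash\Gamma$ are generated by the rules: (Id) $\vdash\Gamma,[R_1]a,\dots,[R_n]a$ for any $\Gamma$, atomic $a$, $n\ge1$ and $R_1\uplus\cdots\uplus R_n=\mathcal{R}$; (contraction) from $\vdash\Gamma,[R]A,[R]A$ infer $\vdash\Gamma,[R]A$; ($\neg$) from $\vdash\Gamma,[f^{ -1}(R)]A$ infer $\vdash\Gamma,[R]\neg_f(A)$; ($\wedge$-neg) if $R\notin\mathcal{U}$, from $\vdash\Gamma,[R]A$ or from $\vdash\Gamma,[R]B$ infer $\vdash\Gamma,[R](A\wedge_{\mathcal{U}}B)$; ($\wedge$-pos) if $R\in\mathcal{U}$, from $\vdash\Gamma,[R]A$ and $\vdash\Gamma,[R]B$ infer $\vdash\Gamma,[R](A\wedge_{\mathcal{U}}B)$; ($\supset$-neg) if $R\notin\mathcal{U}$, from $\vdash\Gamma,[f^{ -1}(R)]A,[R]B$ infer $\vdash\Gamma,[R](A\supset_{f,\mathcal{U}}B)$; ($\supset$-pos) if $R\in\mathcal{U}$, from $\vdash\Gamma_1,[f^{ -1}(R)]A$ and $\vdash\Gamma_2,[R]B$ infer $\vdash\Gamma_1,\Gamma_2,[R](A\supset_{f,\mathcal{U}}B)$; ($\forall$-neg) if $R\notin\mathcal{U}$, from $\vdash\Gamma,[R]A[x:=t]$ for some term $t$ infer $\vdash\Gamma,[R]\forall_{\mathcal{U}}(\lambda x.A)$; ($\forall$-pos) if $R\in\mathcal{U}$ and $x$ has no free occurrence in $\Gamma$, from $\vdash\Gamma,[R]A$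 infer $\vdash\Gamma,[R]\forall_{\mathcal{U}}(\lambda x.A)$. -}

module Defs where

open import Data.Bool using (Bool; true; false; not; _∧_)
open import Data.Nat using (ℕ; zero; suc)
open import Data.List using (List; []; _∷_; _++_; map)
open import Data.Product using (_×_; _,_)
open import Data.Sum using (_⊎_)
open import Data.Empty using (⊥)
open import Relation.Nullary using (¬_)
open import Relation.Binary.PropositionalEquality using (_≡_)
open import Data.List.Relation.Binary.Permutation.Propositional using (_↭_)

module MRL (Role : Set) (Fun : Set) (Pred : Set) where

  Subset : Set
  Subset = Role → Bool

  _∈ˢ_ : Role → Subset → Set
  r ∈ˢ R = R r ≡ true

  full : Subset
  full _ = true

  empty : Subset
  empty _ = false

  ∁ : Subset → Subset
  ∁ R r = not (R r)

  _∩_ : Subset → Subset → Subset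
  (R₁ ∩ R₂) r = R₁ r ∧ R₂ r

  _⊆_ : Subset → Subset → Set
  R₁ ⊆ R₂ = ∀ r → r ∈ˢ R₁ → r ∈ˢ R₂

  Endo : Set
  Endo = Role → Role

  _⁻¹[_] : Endo → Subset → Subset
  (f ⁻¹[ R ]) r = R (f r)

  -- R₁ ⊎ ⋯ ⊎ Rₙ = 𝓡 : every role lies in exactly one of the Rᵢ
  -- number of sets in the list containing r
  count : List Subset → Role → ℕ
  count []       r = 0
  count (R ∷ Rs) r with R r
  ... | true  = suc (count Rs r)
  ... | false = count Rs r

  IsPartition : List Subset → Set
  IsPartition Rs = ∀ r → count Rs r ≡ 1

  record Ultrafilter : Set₁ where
    field
      _∈U   : Subset → Set
      full∈ : full ∈U
      up    : ∀ {R₁ R₂} → R₁ ∈U → R₁ ⊆ R₂ → R₂ ∈U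
      meet  : ∀ {R₁ R₂} → R₁ ∈U → R₂ ∈U → (R₁ ∩ R₂) ∈U
      proper : ¬ (empty ∈U)
      ultra : ∀ R → R ∈U ⊎ (∁ R) ∈U

  open Ultrafilter public

  _∈ᵁ_ : Subset → Ultrafilter → Set
  R ∈ᵁ 𝓤 = _∈U 𝓤 R

  data Term : Set where
    var : ℕ → Term
    app : Fun → List Term → Term

  data Atom : Set where
    pred : Pred → List Term → Atom

  mutual
    substT : (ℕ → Term) → Term → Term
    substT σ (var n)    = σ n
    substT σ (app g ts) = app g (substTs σ ts)

    substTs : (ℕ → Term) → List Term → List Term
    substTs σ []       = []
    substTs σ (t ∷ ts) = substT σ t ∷ substTs σ ts

  substA : (ℕ → Term) → Atom → Atom
  substA σ (pred P ts) = pred P (substTs σ ts)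

  ↑T : Term → Term
  ↑T = substT (λ n → var (suc n))

  exts : (ℕ → Term) → ℕ → Term
  exts σ zero    = var zero
  exts σ (suc n) = ↑T (σ n)

  -- Formulas of MRL
  --   atom a | ¬_f A | A ∧_𝓤 B | A ⊃_{f,𝓤} B | ∀_𝓤 (λ x. A)
  -- In  ∀_𝓤 A  the bound variable x is de Bruijn index 0 of A.

  data Formula : Set₁ where
    atom : Atom → Formula
    neg  : Endo → Formula → Formula
    conj : Ultrafilter → Formula → Formula → Formula
    imp  : Endo → Ultrafilter → Formula → Formula → Formula
    all  : Ultrafilter → Formula → Formula

  substF : (ℕ → Term) → Formula → Formula
  substF σ (atom a)       = atom (substA σ a)
  substF σ (neg f A)      = neg f (substF σ A)
  substF σ (conj 𝓤 A B)   = conj 𝓤 (substF σ A) (substF σ B)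
  substF σ (imp f 𝓤 A B)  = imp f 𝓤 (substF σ A) (substF σ B)
  substF σ (all 𝓤 A)      = all 𝓤 (substF (exts σ) A)

  -- A[x := t]  for the variable x bound by the enclosing ∀ (index 0)
  _[_] : Formula → Term → Formula
  A [ t ] = substF σ A
    where
      σ : ℕ → Term
      σ zero    = t
      σ (suc n) = var n

  ↑F : Formula → Formula
  ↑F = substF (λ n → var (suc n))

  IFormula : Set₁
  IFormula = Subset × Formula

  -- sequents: finite multisets, represented as lists up to permutation
  -- (see the rule  perm  below)
  Sequent : Set₁
  Sequent = List IFormula

  ↑S : Sequent → Sequent
  ↑S = map (λ { (R , A) → (R , ↑F A) })

  data ⊢_ : Sequent → Set₁ where
    perm   : ∀ {Γ Δ} → Γ ↭ Δ → ⊢ Γ → ⊢ Δ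
    Id     : ∀ Γ (a : Atom) (R : Subset) (Rs : List Subset) →
             IsPartition (R ∷ Rs) →
             ⊢ (map (λ S → (S , atom a)) (R ∷ Rs) ++ Γ)
    contr  : ∀ {Γ R A} → ⊢ ((R , A) ∷ (R , A) ∷ Γ) → ⊢ ((R , A) ∷ Γ)
    ¬-rule : ∀ {Γ R f A} → ⊢ ((f ⁻¹[ R ] , A) ∷ Γ) → ⊢ ((R , neg f A) ∷ Γ)
    ∧-neg₁ : ∀ {Γ R 𝓤 A B} → ¬ (R ∈ᵁ 𝓤) →
             ⊢ ((R , A) ∷ Γ) → ⊢ ((R , conj 𝓤 A B) ∷ Γ)
    ∧-neg₂ : ∀ {Γ R 𝓤 A B} → ¬ (R ∈ᵁ 𝓤) →
             ⊢ ((R , B) ∷ Γ) → ⊢ ((R , conj 𝓤 A B) ∷ Γ)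
    ∧-pos  : ∀ {Γ R 𝓤 A B} → R ∈ᵁ 𝓤 →
             ⊢ ((R , A) ∷ Γ) → ⊢ ((R , B) ∷ Γ) → ⊢ ((R , conj 𝓤 A B) ∷ Γ)
    ⊃-neg  : ∀ {Γ R f 𝓤 A B} → ¬ (R ∈ᵁ 𝓤) →
             ⊢ ((f ⁻¹[ R ] , A) ∷ (R , B) ∷ Γ) → ⊢ ((R , imp f 𝓤 A B) ∷ Γ)
    ⊃-pos  : ∀ {Γ₁ Γ₂ R f 𝓤 A B} → R ∈ᵁ 𝓤 →
             ⊢ ((f ⁻¹[ R ] , A) ∷ Γ₁) → ⊢ ((R , B) ∷ Γ₂) →
             ⊢ ((R , imp f 𝓤 A B) ∷ (Γ₁ ++ Γ₂))
    ∀-neg  : ∀ {Γ R 𝓤 A} (t : Term) → ¬ (R ∈ᵁ 𝓤) →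
             ⊢ ((R , A [ t ]) ∷ Γ) → ⊢ ((R , all 𝓤 A) ∷ Γ)
    -- eigenvariable condition: the premise lives in a context extended by
    -- the fresh variable x (index 0), and Γ is weakened (↑S), so x has no
    -- free occurrence in Γ
    ∀-pos  : ∀ {Γ R 𝓤 A} → R ∈ᵁ 𝓤 →
             ⊢ ((R , A) ∷ ↑S Γ) → ⊢ ((R , all 𝓤 A) ∷ Γ)

-- By induction on A, generalised to any complementary pair R, S = 𝓡 ∖ R (preimages
-- preserve complementation, which handles ¬_f and the left premise of ⊃). For a
-- connective carrying an ultrafilter 𝓤, exactly one of R, S lies in 𝓤: apply the
-- positive rule on that side, then the negative rule on the other, which picks
-- the matching premise, and close with the induction hypothesis. For ∀ the
-- witness of the negative rule is the eigenvariable of the positive one.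
module Submission where

open import Defs
open import Data.Bool using (true; false; not; _∧_)
open import Data.Bool.Properties using (not-involutive; ∧-inverseʳ)
open import Data.List using ([]; _∷_; _++_)
open import Data.Nat using (ℕ; zero; suc)
open import Data.Product using (_,_)
open import Data.Sum using (_⊎_; inj₁; inj₂)
open import Function using (_∘_)
open import Relation.Binary.PropositionalEquality
  using (_≡_; _≗_; refl; sym; trans; cong; cong₂; subst; module ≡-Reasoning)
open import Relation.Nullary using (¬_)
open import Data.List.Relation.Binary.Permutation.Propositional using (↭-sym; swap; ↭-refl)
open import Data.List.Relation.Binary.Permutation.Propositional.Properties using (shift; ++-comm)

module Substitution (Role Fun Pred : Set) where
  open MRL Role Fun Pred

  mutual
    substT-fusion : ∀ σ τ t → substT τ (substT σ t) ≡ substT (substT τ ∘ σ) t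
    substT-fusion σ τ (var n)    = refl
    substT-fusion σ τ (app g ts) = cong (app g) (substTs-fusion σ τ ts)

    substTs-fusion : ∀ σ τ ts → substTs τ (substTs σ ts) ≡ substTs (substT τ ∘ σ) ts
    substTs-fusion σ τ []       = refl
    substTs-fusion σ τ (t ∷ ts) = cong₂ _∷_ (substT-fusion σ τ t) (substTs-fusion σ τ ts)

  module _ {σ τ : ℕ → Term} (τ∘σ≗var : substT τ ∘ σ ≗ var) where
    mutual
      substT-inverse : ∀ t → substT τ (substT σ t) ≡ t
      substT-inverse (var n)    = τ∘σ≗var n
      substT-inverse (app g ts) = cong (app g) (substTs-inverse ts)

      substTs-inverse : ∀ ts → substTs τ (substTs σ ts) ≡ ts
      substTs-inverse []       = refl
      substTs-inverse (t ∷ ts) = cong₂ _∷_ (substT-inverse t) (substTs-inverse ts)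

    exts-inverse : substT (exts τ) ∘ exts σ ≗ var
    exts-inverse zero    = refl
    exts-inverse (suc n) = begin
      substT (exts τ) (↑T (σ n))  ≡⟨ substT-fusion _ (exts τ) (σ n) ⟩
      substT (↑T ∘ τ) (σ n)       ≡⟨ substT-fusion τ _ (σ n) ⟨
      ↑T (substT τ (σ n))         ≡⟨ cong ↑T (τ∘σ≗var n) ⟩
      var (suc n)                 ∎
      where open ≡-Reasoning

  substF-inverse : ∀ {σ τ} → substT τ ∘ σ ≗ var → ∀ A → substF τ (substF σ A) ≡ A
  substF-inverse h (atom (pred P ts)) = cong (atom ∘ pred P) (substTs-inverse h ts)
  substF-inverse h (neg f A)          = cong (neg f) (substF-inverse h A)
  substF-inverse h (conj 𝓤 A B)       = cong₂ (conj 𝓤) (substF-inverse h A) (substF-inverse h B)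
  substF-inverse h (imp f 𝓤 A B)      = cong₂ (imp f 𝓤) (substF-inverse h A) (substF-inverse h B)
  substF-inverse h (all 𝓤 A)          = cong (all 𝓤) (substF-inverse (exts-inverse h) A)

  lifted-↑F-[var0] : ∀ A → substF (exts (var ∘ suc)) A [ var 0 ] ≡ A
  lifted-↑F-[var0] A = substF-inverse (λ { zero → refl ; (suc n) → refl }) A

module ExcludedMiddle (Role Fun Pred : Set) where
  open MRL Role Fun Pred
  open Substitution Role Fun Pred using (lifted-↑F-[var0])

  ∁-sym : ∀ {R S} → S ≗ ∁ R → R ≗ ∁ S
  ∁-sym {R} S≗∁R r = trans (sym (not-involutive (R r))) (cong not (sym (S≗∁R r)))

  ∁-isPartition : ∀ {R S} → S ≗ ∁ R → IsPartition (R ∷ S ∷ [])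
  ∁-isPartition {R} S≗∁R r with R r in Rr
  ... | true  rewrite S≗∁R r | Rr = refl
  ... | false rewrite S≗∁R r | Rr = refl

  ∁-∉ᵁ : ∀ 𝓤 {R S} → S ≗ ∁ R → R ∈ᵁ 𝓤 → ¬ (S ∈ᵁ 𝓤)
  ∁-∉ᵁ 𝓤 {R} {S} S≗∁R R∈𝓤 S∈𝓤 = proper 𝓤 (up 𝓤 (meet 𝓤 R∈𝓤 S∈𝓤) R∩S⊆empty)
    where
      R∩S⊆empty : (R ∩ S) ⊆ empty
      R∩S⊆empty r R∩Sr =
        trans (sym (∧-inverseʳ (R r))) (trans (cong (R r ∧_) (sym (S≗∁R r))) R∩Sr)

  ∁-∈ᵁ : ∀ 𝓤 {R S} → S ≗ ∁ R → R ∈ᵁ 𝓤 ⊎ S ∈ᵁ 𝓤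
  ∁-∈ᵁ 𝓤 {R} S≗∁R with ultra 𝓤 R
  ... | inj₁ R∈𝓤  = inj₁ R∈𝓤
  ... | inj₂ ∁R∈𝓤 = inj₂ (up 𝓤 ∁R∈𝓤 λ r ∁Rr → trans (S≗∁R r) ∁Rr)

  ⊢-swap : ∀ {x y Γ} → ⊢ (x ∷ y ∷ Γ) → ⊢ (y ∷ x ∷ Γ)
  ⊢-swap = perm (swap _ _ ↭-refl)

  -- Stated for S ≗ ∁ R rather than S = ∁ R because the relation is symmetric (∁-sym)
  -- whereas ∁ (∁ R) is not definitionally R.
  ExcludedMiddle : Formula → Set₁
  ExcludedMiddle A = ∀ Γ {R S} → S ≗ ∁ R → ⊢ ((R , A) ∷ (S , A) ∷ Γ)

  OrientedBy : Ultrafilter → Formula → Set₁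
  OrientedBy 𝓤 A = ∀ Γ {R S} → S ≗ ∁ R → R ∈ᵁ 𝓤 → ¬ (S ∈ᵁ 𝓤) → ⊢ ((R , A) ∷ (S , A) ∷ Γ)

  orientedBy⇒excludedMiddle : ∀ 𝓤 {A} → OrientedBy 𝓤 A → ExcludedMiddle A
  orientedBy⇒excludedMiddle 𝓤 oriented Γ S≗∁R with ∁-∈ᵁ 𝓤 S≗∁R
  ... | inj₁ R∈𝓤 = oriented Γ S≗∁R R∈𝓤 (∁-∉ᵁ 𝓤 S≗∁R R∈𝓤)
  ... | inj₂ S∈𝓤 = ⊢-swap (oriented Γ R≗∁S S∈𝓤 (∁-∉ᵁ 𝓤 R≗∁S S∈𝓤))
    where R≗∁S = ∁-sym S≗∁R

  atom-excludedMiddle : ∀ a → ExcludedMiddle (atom a)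
  atom-excludedMiddle a Γ {R} {S} S≗∁R = Id Γ a R (S ∷ []) (∁-isPartition S≗∁R)

  neg-excludedMiddle : ∀ f {A} → ExcludedMiddle A → ExcludedMiddle (neg f A)
  neg-excludedMiddle f em-A Γ S≗∁R =
    ¬-rule (⊢-swap (¬-rule (⊢-swap (em-A Γ (S≗∁R ∘ f)))))

  conj-orientedBy : ∀ 𝓤 {A B} → ExcludedMiddle A → ExcludedMiddle B → OrientedBy 𝓤 (conj 𝓤 A B)
  conj-orientedBy 𝓤 em-A em-B Γ S≗∁R R∈𝓤 S∉𝓤 =
    ∧-pos R∈𝓤 (⊢-swap (∧-neg₁ S∉𝓤 (⊢-swap (em-A Γ S≗∁R))))
              (⊢-swap (∧-neg₂ S∉𝓤 (⊢-swap (em-B Γ S≗∁R))))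

  imp-orientedBy : ∀ f 𝓤 {A B} → ExcludedMiddle A → ExcludedMiddle B → OrientedBy 𝓤 (imp f 𝓤 A B)
  imp-orientedBy f 𝓤 {A} {B} em-A em-B Γ {R} {S} S≗∁R R∈𝓤 S∉𝓤 =
    ⊢-swap (⊃-neg S∉𝓤 (perm (↭-sym (shift (R , imp f 𝓤 A B) ((f ⁻¹[ S ] , A) ∷ (S , B) ∷ []) Γ))
      (⊃-pos {Γ₁ = (f ⁻¹[ S ] , A) ∷ []} R∈𝓤 (em-A [] (S≗∁R ∘ f)) (em-B Γ S≗∁R))))

  all-orientedBy : ∀ 𝓤 {A} → ExcludedMiddle A → OrientedBy 𝓤 (all 𝓤 A)
  all-orientedBy 𝓤 {A} em-A Γ {R} {S} S≗∁R R∈𝓤 S∉𝓤 =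
    ∀-pos R∈𝓤 (⊢-swap (∀-neg (var 0) S∉𝓤 (⊢-swap premise)))
    where
      -- ∀-pos weakens (S , all 𝓤 A) to (S , all 𝓤 (substF (exts (var ∘ suc)) A)).
      premise : ⊢ ((R , A) ∷ (S , substF (exts (var ∘ suc)) A [ var 0 ]) ∷ ↑S Γ)
      premise = subst (λ A′ → ⊢ ((R , A) ∷ (S , A′) ∷ ↑S Γ)) (sym (lifted-↑F-[var0] A))
                      (em-A (↑S Γ) S≗∁R)

  excludedMiddle : ∀ A → ExcludedMiddle A
  excludedMiddle (atom a)      = atom-excludedMiddle a
  excludedMiddle (neg f A)     = neg-excludedMiddle f (excludedMiddle A)
  excludedMiddle (conj 𝓤 A B)  =
    orientedBy⇒excludedMiddle 𝓤 (conj-orientedBy 𝓤 (excludedMiddle A) (excludedMiddle B))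
  excludedMiddle (imp f 𝓤 A B) =
    orientedBy⇒excludedMiddle 𝓤 (imp-orientedBy f 𝓤 (excludedMiddle A) (excludedMiddle B))
  excludedMiddle (all 𝓤 A)     =
    orientedBy⇒excludedMiddle 𝓤 (all-orientedBy 𝓤 (excludedMiddle A))

lemma4 : (Role Fun Pred : Set) →
         (Γ : MRL.Sequent Role Fun Pred) (R : MRL.Subset Role Fun Pred) (A : MRL.Formula Role Fun Pred) →
         MRL.⊢_ Role Fun Pred (Γ ++ (R , A) ∷ (MRL.∁ Role Fun Pred R , A) ∷ [])
lemma4 Role Fun Pred Γ R A =
  perm (++-comm ((R , A) ∷ (∁ R , A) ∷ []) Γ) (excludedMiddle A Γ λ _ → refl)
  where
    open MRL Role Fun Pred
    open ExcludedMiddle Role Fun Pred
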